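{- The hypersequent $J=\ \Rightarrow p\,/\!/\,\Rightarrow\Box(\neg\Box\Box p\land\neg\Box\Box q)\,/\!/\,\Rightarrow q$ is valid in the class of $\mathbf{B}$ (reflexive and symmetric) Kripke frames.
   Context: A Kripke model $\langle W,R,v\rangle$ has classical truth conditions with $v(\Box\phi,x)=1$ iff $v(\phi,y)=1$ for all $y$ with $xRy$. A hypersequent $\Gamma_1\Rightarrow\Delta_1\,/\!/\,\dots\,/\!/\,\Gamma_n\Rightarrow\Delta_n$ has a countermodel if there is a branch $w_1,\dots,w_n$ with $w_iRw_{i+1}$ such that at each $w_i$ all formulas of $\Gamma_i$ are true and all formulas of $\Delta_i$ are false; it is valid in a class of frames if it has no countermodel there. -}

module Defs where

open import Data.Nat using (ℕ)
open import Data.Bool using (Bool; true)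
open import Data.Product using (_×_; Σ; _,_)
open import Data.Empty using (⊥)
open import Data.Unit using (⊤)
open import Data.List using (List; []; _∷_)
open import Data.List.Relation.Unary.All using (All)
open import Relation.Nullary using (¬_)
open import Relation.Binary.PropositionalEquality using (_≡_)
open import Level using (Level; _⊔_; suc)

data Fm : Set where
  atom : ℕ → Fm
  ⊥ᶠ   : Fm
  ¬ᶠ_  : Fm → Fm
  _∧ᶠ_ : Fm → Fm → Fm
  _∨ᶠ_ : Fm → Fm → Fm
  _⇒ᶠ_ : Fm → Fm → Fm
  □_   : Fm → Fm

record Frame (w r : Level) : Set (Level.suc (w ⊔ r)) where
  field
    W : Set w
    R : W → W → Set r

Reflexive : ∀ {w r} → Frame w r → Set (w ⊔ r)
Reflexive F = ∀ x → Frame.R F x x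

Symmetric : ∀ {w r} → Frame w r → Set (w ⊔ r)
Symmetric F = ∀ {x y} → Frame.R F x y → Frame.R F y x

IsB : ∀ {w r} → Frame w r → Set (w ⊔ r)
IsB F = Reflexive F × Symmetric F

record Model (w r : Level) : Set (Level.suc (w ⊔ r)) where
  field
    frame : Frame w r
    val   : ℕ → Frame.W frame → Bool
  open Frame frame public

module _ {w r} (M : Model w r) where
  open Model M
  Tr : Fm → W → Set (w ⊔ r)
  Tr (atom n) x = Level.Lift (w ⊔ r) (val n x ≡ true)
  Tr ⊥ᶠ x = Level.Lift (w ⊔ r) ⊥
  Tr (¬ᶠ φ) x = ¬ Tr φ x
  Tr (φ ∧ᶠ ψ) x = Tr φ x × Tr ψ x
  Tr (φ ∨ᶠ ψ) x = ¬ (¬ Tr φ x × ¬ Tr ψ x)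
  Tr (φ ⇒ᶠ ψ) x = Tr φ x → Tr ψ x
  Tr (□ φ) x = ∀ y → R x y → Tr φ y

record Seq : Set where
  constructor _⊢_
  field
    ante : List Fm
    succ : List Fm

HSeq : Set
HSeq = List Seq

module _ {w r} (M : Model w r) where
  open Model M
  Refutes : W → Seq → Set (w ⊔ r)
  Refutes x (Γ ⊢ Δ) = All (λ φ → Tr M φ x) Γ × All (λ φ → ¬ Tr M φ x) Δ

  -- branch w₁ R w₂ R … R wₙ refuting the components in order, starting at x
  RefutedFrom : W → HSeq → Set (w ⊔ r)
  RefutedFrom x [] = Level.Lift (w ⊔ r) ⊤
  RefutedFrom x (S ∷ []) = Refutes x S
  RefutedFrom x (S ∷ T ∷ H) = Refutes x S × Σ W (λ y → R x y × RefutedFrom y (T ∷ H))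

  Countermodel : HSeq → Set (w ⊔ r)
  Countermodel [] = Level.Lift (w ⊔ r) ⊤
  Countermodel H@(_ ∷ _) = Σ W (λ x → RefutedFrom x H)

ValidB : ∀ w r → HSeq → Set (Level.suc (w ⊔ r))
ValidB w r H = (M : Model w r) → IsB (Model.frame M) → ¬ Countermodel M H

p q : Fm
p = atom 0
q = atom 1

J : HSeq
J = ([] ⊢ (p ∷ []))
  ∷ ([] ⊢ ((□ ((¬ᶠ (□ (□ p))) ∧ᶠ (¬ᶠ (□ (□ q))))) ∷ []))
  ∷ ([] ⊢ (q ∷ []))
  ∷ []

{-# OPTIONS --safe #-}
-- Let x R y R v be a branch refuting J. Every successor z of y sees y again by
-- symmetry, so z R y R x and z R y R v; as p fails at x and q fails at v,
-- both □□p and □□q fail at z. Hence □(¬□□p ∧ ¬□□q) holds at y after all.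
module Submission where

open import Defs
open import Level using (Level)
open import Data.Product using (_,_)
open import Data.List.Relation.Unary.All using ([]; _∷_)
open import Relation.Nullary using (¬_)

module _ {w r} (M : Model w r) where
  open Model M

  ¬□□-at-two-step-predecessor : ∀ {φ x y z} → R z y → R y x → ¬ Tr M φ x → ¬ Tr M (□ □ φ) z
  ¬□□-at-two-step-predecessor zy yx ¬φx □□φz = ¬φx (□□φz _ zy _ yx)

  □¬□□-between-refutations : Symmetric frame → ∀ {φ ψ x y v} →
    R y x → R y v → ¬ Tr M φ x → ¬ Tr M ψ v →
    Tr M (□ ((¬ᶠ (□ (□ φ))) ∧ᶠ (¬ᶠ (□ (□ ψ))))) y
  □¬□□-between-refutations sym yx yv ¬φx ¬ψv z yz =
      ¬□□-at-two-step-predecessor (sym yz) yx ¬φx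
    , ¬□□-at-two-step-predecessor (sym yz) yv ¬ψv

mainTheorem12 : ∀ (w r : Level) → ValidB w r J
mainTheorem12 w r M (_ , sym)
  (x , (_ , ¬p ∷ []) , y , xy , (_ , ¬□ ∷ []) , v , yv , (_ , ¬q ∷ [])) =
  ¬□ (□¬□□-between-refutations M sym {p} {q} (sym xy) yv ¬p ¬q)
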